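{- Let $(L,\wedge,\vee,0,1,\lnot)$ be an Ex-lattice. Then there exist an ortholattice $O_L$, a Heyting lattice $A_L$, and an injective fundamental homomorphism (embedding) $e:L\to O_L\times A_L$.
   Context: A fundamental lattice is a bounded lattice $(L,\wedge,\vee,0,1)$ with a unary operation $\lnot$ such that $a\le b$ implies $\lnot b\le\lnot a$, $a\wedge\lnot a=0$, and $a\le\lnot\lnot a$. An ortholattice is a fundamental lattice with $\lnot\lnot a=a$ for all $a$. A Heyting lattice is a distributive fundamental lattice such that $a\wedge b=0$ implies $b\le\lnot a$. An Ex-lattice is a fundamental lattice in which, for all $a,b,c,d,e,f$: $\lnot\big[a\wedge((b\wedge c)\vee(b\wedge d))\big]\wedge a\wedge(c\vee e)\wedge\lnot\lnot f \le \lnot\lnot(a\wedge f)\wedge\big[(a\wedge c)\vee(a\wedge e)\vee f\big]\wedge\big[(b\wedge(c\vee d))\vee\lnot(b\wedge(c\vee d))\big]$. A fundamental homomorphism is a map preserving $0,1,\wedge,\vee,\lnot$. The product $O\times A$ is ordered and operated componentwise, with $\lnot(x,y)=(\lnot x,\lnot y)$. -}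

module Defs where

open import Level using (Level; _⊔_) renaming (suc to lsuc)
open import Algebra.Core using (Op₁; Op₂)
open import Algebra.Lattice.Structures using (IsLattice; IsDistributiveLattice)
open import Data.Product using (_×_; _,_; proj₁; proj₂)

record FundamentalLattice (c ℓ : Level) : Set (lsuc (c ⊔ ℓ)) where
  infix  4 _≈_ _≤_
  infixr 7 _∧_
  infixr 6 _∨_
  field
    Carrier   : Set c
    _≈_       : Carrier → Carrier → Set ℓ
    _∧_       : Op₂ Carrier
    _∨_       : Op₂ Carrier
    𝟘         : Carrier
    𝟙         : Carrier
    ¬_        : Op₁ Carrier
    isLattice : IsLattice _≈_ _∨_ _∧_
    ¬-cong    : ∀ {a b} → a ≈ b → (¬ a) ≈ (¬ b)

  _≤_ : Carrier → Carrier → Set ℓ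
  a ≤ b = (a ∧ b) ≈ a

  field
    𝟘-least    : ∀ a → 𝟘 ≤ a
    𝟙-greatest : ∀ a → a ≤ 𝟙
    ¬-antitone : ∀ {a b} → a ≤ b → (¬ b) ≤ (¬ a)
    ∧-¬        : ∀ a → (a ∧ (¬ a)) ≈ 𝟘
    ≤-¬¬       : ∀ a → a ≤ (¬ (¬ a))

  open IsLattice isLattice public

module _ {c ℓ : Level} (L : FundamentalLattice c ℓ) where
  open FundamentalLattice L

  IsOrtholattice : Set (c ⊔ ℓ)
  IsOrtholattice = ∀ a → (¬ (¬ a)) ≈ a

  record IsHeytingLattice : Set (c ⊔ ℓ) where
    field
      distributive : IsDistributiveLattice _≈_ _∨_ _∧_
      pseudocompl  : ∀ a b → (a ∧ b) ≈ 𝟘 → b ≤ (¬ a)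

  IsExLattice : Set (c ⊔ ℓ)
  IsExLattice = ∀ a b c d e f →
    ((¬ (a ∧ ((b ∧ c) ∨ (b ∧ d)))) ∧ a ∧ (c ∨ e) ∧ (¬ (¬ f)))
      ≤ ((¬ (¬ (a ∧ f))) ∧ ((a ∧ c) ∨ (a ∧ e) ∨ f)
          ∧ ((b ∧ (c ∨ d)) ∨ (¬ (b ∧ (c ∨ d)))))

module _ {c₁ ℓ₁ c₂ ℓ₂ c₃ ℓ₃ : Level}
         (L : FundamentalLattice c₁ ℓ₁)
         (O : FundamentalLattice c₂ ℓ₂)
         (A : FundamentalLattice c₃ ℓ₃) where
  private
    module L = FundamentalLattice L
    module O = FundamentalLattice O
    module A = FundamentalLattice A

  _≈×_ : O.Carrier × A.Carrier → O.Carrier × A.Carrier → Set (ℓ₂ ⊔ ℓ₃)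
  (x , y) ≈× (x' , y') = (x O.≈ x') × (y A.≈ y')

  record IsFundamentalEmbedding (e : L.Carrier → O.Carrier × A.Carrier)
         : Set (c₁ ⊔ ℓ₁ ⊔ ℓ₂ ⊔ ℓ₃) where
    field
      cong      : ∀ {a b} → a L.≈ b → e a ≈× e b
      pres-𝟘    : e L.𝟘 ≈× (O.𝟘 , A.𝟘)
      pres-𝟙    : e L.𝟙 ≈× (O.𝟙 , A.𝟙)
      pres-∧    : ∀ a b → e (a L.∧ b)
                    ≈× ((proj₁ (e a) O.∧ proj₁ (e b)) , (proj₂ (e a) A.∧ proj₂ (e b)))
      pres-∨    : ∀ a b → e (a L.∨ b)
                    ≈× ((proj₁ (e a) O.∨ proj₁ (e b)) , (proj₂ (e a) A.∨ proj₂ (e b)))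
      pres-¬    : ∀ a → e (L.¬ a) ≈× (O.¬ proj₁ (e a) , A.¬ proj₂ (e a))
      injective : ∀ {a b} → e a ≈× e b → a L.≈ b

{-# OPTIONS --safe #-}
module Submission where

-- Call k dense when ¬ k ≈ 𝟘. Instances of the Ex axiom give x ∧ ¬ ¬ y ≤ ¬ ¬ (x ∧ y), and
-- distributivity and excluded middle up to dense elements. So x ≤ᵈ y, meaning x ≤ y ∨ k for
-- every dense k, is a preorder modulo which ∧ distributes over ∨ and x ∧ y ≈ 𝟘 gives x ≤ᵈ ¬ y.
-- O_L identifies x and y when ¬ x ≈ ¬ y: the first inequality makes this a congruence, and
-- ¬ ¬ ¬ x ≈ ¬ x makes the quotient an ortholattice. A_L identifies x and y when x ≈ᵈ y and
-- ¬ (x ∧ z) ≈ᵈ ¬ (y ∧ z) for all z; the second clause is what makes ¬ respect it, and the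
-- properties of ≤ᵈ make the quotient distributive and pseudocomplemented. The diagonal map
-- L → O_L × A_L is injective because x ≈ ¬ ¬ x ∧ (x ∨ ¬ x): the first factor is determined by
-- ¬ x, and the second by ¬ x and the class of x modulo ≈ᵈ, since y ∨ ¬ y is itself dense.

open import Defs
open import Level using (Level; _⊔_; Lift; lift; lower)
open import Data.Product using (Σ; _×_; _,_; proj₂)
open import Algebra.Core using (Op₂)
open import Algebra.Definitions using (Congruent₁; Congruent₂; _DistributesOverˡ_; _DistributesOver_)
open import Algebra.Consequences.Setoid using (comm∧distrˡ⇒distr; distrib∧absorbs⇒distribˡ)
open import Algebra.Lattice.Bundles using (Lattice)
open import Algebra.Lattice.Structures using (IsLattice; IsDistributiveLattice)
import Algebra.Lattice.Properties.Lattice as LatticeProperties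
open import Relation.Binary.Core using (Rel; _⇒_)
open import Relation.Binary.Bundles using (Setoid; Preorder; Poset)
open import Relation.Binary.Structures using (IsEquivalence)
import Relation.Binary.Lattice as Order
import Relation.Binary.Lattice.Properties.JoinSemilattice as JoinSemilatticeProperties
import Relation.Binary.Lattice.Properties.MeetSemilattice as MeetSemilatticeProperties
import Relation.Binary.Properties.Preorder as PreorderProperties
import Relation.Binary.Reasoning.Setoid as ≈-Reasoning
import Relation.Binary.Reasoning.Preorder as PreorderReasoning

module FundamentalLatticeProperties {c ℓ : Level} (L : FundamentalLattice c ℓ) where
  open FundamentalLattice L public

  lattice : Lattice c ℓ
  lattice = record { isLattice = isLattice }

  open LatticeProperties lattice public using (∧-idem)

  private
    module Natural = Order.Lattice (LatticeProperties.∨-∧-orderTheoreticLattice lattice)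

  -- The library orders a lattice by x ≈ x ∧ y, the converse equation of _≤_.
  orderLattice : Order.Lattice c ℓ ℓ
  orderLattice = record
    { _≤_       = _≤_
    ; isLattice = record
      { isPartialOrder = record
        { isPreorder = record
          { isEquivalence = isEquivalence
          ; reflexive     = λ x≈y → sym (Natural.reflexive x≈y)
          ; trans         = λ x≤y y≤z → sym (Natural.trans (sym x≤y) (sym y≤z))
          }
        ; antisym = λ x≤y y≤x → Natural.antisym (sym x≤y) (sym y≤x)
        }
      ; supremum = λ x y → let x≤x∨y , y≤x∨y , least = Natural.supremum x y in
          sym x≤x∨y , sym y≤x∨y , λ z x≤z y≤z → sym (least z (sym x≤z) (sym y≤z))
      ; infimum  = λ x y → let x∧y≤x , x∧y≤y , greatest = Natural.infimum x y in
          sym x∧y≤x , sym x∧y≤y , λ z z≤x z≤y → sym (greatest z (sym z≤x) (sym z≤y))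
      }
    }

  open Order.Lattice orderLattice public
    using (poset; x∧y≤x; x∧y≤y; ∧-greatest; x≤x∨y; y≤x∨y; ∨-least)
  open Poset poset public
    using () renaming (refl to ≤-refl; reflexive to ≤-reflexive; trans to ≤-trans; antisym to ≤-antisym)
  open MeetSemilatticeProperties (Order.Lattice.meetSemilattice orderLattice) public
    using (∧-monotonic)
  open JoinSemilatticeProperties (Order.Lattice.joinSemilattice orderLattice) public
    using (∨-monotonic)

  setoid : Setoid c ℓ
  setoid = record { isEquivalence = isEquivalence }

  ≤𝟘⇒≈𝟘 : ∀ {x} → x ≤ 𝟘 → x ≈ 𝟘
  ≤𝟘⇒≈𝟘 x≤𝟘 = ≤-antisym x≤𝟘 (𝟘-least _)

  𝟙≤⇒≈𝟙 : ∀ {x} → 𝟙 ≤ x → x ≈ 𝟙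
  𝟙≤⇒≈𝟙 𝟙≤x = ≤-antisym (𝟙-greatest _) 𝟙≤x

  ¬𝟙≈𝟘 : ¬ 𝟙 ≈ 𝟘
  ¬𝟙≈𝟘 = trans (sym (𝟙-greatest (¬ 𝟙))) (trans (∧-comm (¬ 𝟙) 𝟙) (∧-¬ 𝟙))

  ¬𝟘≈𝟙 : ¬ 𝟘 ≈ 𝟙
  ¬𝟘≈𝟙 = 𝟙≤⇒≈𝟙 (≤-trans (≤-¬¬ 𝟙) (≤-reflexive (¬-cong ¬𝟙≈𝟘)))

  ≈𝟘⇒¬≈𝟙 : ∀ {x} → x ≈ 𝟘 → ¬ x ≈ 𝟙
  ≈𝟘⇒¬≈𝟙 x≈𝟘 = trans (¬-cong x≈𝟘) ¬𝟘≈𝟙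

  ≤𝟘⇒≤¬ : ∀ {x y} → y ≤ 𝟘 → x ≤ ¬ y
  ≤𝟘⇒≤¬ y≤𝟘 = ≤-trans (𝟙-greatest _) (≤-reflexive (sym (≈𝟘⇒¬≈𝟙 (≤𝟘⇒≈𝟘 y≤𝟘))))

  ¬¬¬≈¬ : ∀ x → ¬ ¬ ¬ x ≈ ¬ x
  ¬¬¬≈¬ x = ≤-antisym (¬-antitone (≤-¬¬ x)) (≤-¬¬ (¬ x))

  ¬-∨ : ∀ x y → ¬ (x ∨ y) ≈ ¬ x ∧ ¬ y
  ¬-∨ x y = ≤-antisym
    (∧-greatest (¬-antitone (x≤x∨y x y)) (¬-antitone (y≤x∨y x y)))
    (≤-trans (≤-¬¬ _) (¬-antitone (∨-least
      (≤-trans (≤-¬¬ x) (¬-antitone (x∧y≤x _ _)))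
      (≤-trans (≤-¬¬ y) (¬-antitone (x∧y≤y _ _))))))

  ≤∧≤¬⇒≤𝟘 : ∀ {x y} → x ≤ y → x ≤ ¬ y → x ≤ 𝟘
  ≤∧≤¬⇒≤𝟘 {y = y} x≤y x≤¬y = ≤-trans (∧-greatest x≤y x≤¬y) (≤-reflexive (∧-¬ y))

  Dense : Carrier → Set ℓ
  Dense k = ¬ k ≈ 𝟘

  x∨¬x-dense : ∀ x → Dense (x ∨ ¬ x)
  x∨¬x-dense x = trans (¬-∨ x (¬ x)) (∧-¬ (¬ x))

record IsCongruence {c ℓ ℓ′ : Level} (L : FundamentalLattice c ℓ)
                    (_∼_ : Rel (FundamentalLattice.Carrier L) ℓ′) : Set (c ⊔ ℓ ⊔ ℓ′) where
  private module L = FundamentalLattice L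
  field
    isEquivalence : IsEquivalence _∼_
    reflexive     : L._≈_ ⇒ _∼_
    ∧-cong        : Congruent₂ _∼_ L._∧_
    ∨-cong        : Congruent₂ _∼_ L._∨_
    ¬-cong        : Congruent₁ _∼_ L.¬_

module _ {c ℓ ℓ′ : Level} (L : FundamentalLattice c ℓ)
         {_∼_ : Rel (FundamentalLattice.Carrier L) ℓ′} where
  open FundamentalLatticeProperties L

  _/_ : IsCongruence L _∼_ → FundamentalLattice (c ⊔ ℓ′) ℓ′
  _/_ θ = record
    { Carrier    = Lift ℓ′ Carrier
    ; _≈_        = λ x y → lower x ∼ lower y
    ; _∧_        = λ x y → lift (lower x ∧ lower y)
    ; _∨_        = λ x y → lift (lower x ∨ lower y)
    ; 𝟘          = lift 𝟘
    ; 𝟙          = lift 𝟙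
    ; ¬_         = λ x → lift (¬ lower x)
    ; isLattice  = record
      { isEquivalence = record { refl = θ.reflexive refl ; sym = θ.sym ; trans = θ.trans }
      ; ∨-comm        = λ x y → θ.reflexive (∨-comm (lower x) (lower y))
      ; ∨-assoc       = λ x y z → θ.reflexive (∨-assoc (lower x) (lower y) (lower z))
      ; ∨-cong        = θ.∨-cong
      ; ∧-comm        = λ x y → θ.reflexive (∧-comm (lower x) (lower y))
      ; ∧-assoc       = λ x y z → θ.reflexive (∧-assoc (lower x) (lower y) (lower z))
      ; ∧-cong        = θ.∧-cong
      ; absorptive    = (λ x y → θ.reflexive (∨-absorbs-∧ (lower x) (lower y)))
                      , (λ x y → θ.reflexive (∧-absorbs-∨ (lower x) (lower y)))
      }
    ; ¬-cong     = θ.¬-cong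
    ; 𝟘-least    = λ x → θ.reflexive (𝟘-least (lower x))
    ; 𝟙-greatest = λ x → θ.reflexive (𝟙-greatest (lower x))
    ; ¬-antitone = λ {x} {y} x∧y∼x →
        θ.trans (θ.∧-cong (θ.reflexive refl) (θ.¬-cong (θ.sym x∧y∼x)))
                (θ.reflexive (¬-antitone (x∧y≤y (lower x) (lower y))))
    ; ∧-¬        = λ x → θ.reflexive (∧-¬ (lower x))
    ; ≤-¬¬       = λ x → θ.reflexive (≤-¬¬ (lower x))
    }
    where
    module θ where
      open IsCongruence θ public
      open IsEquivalence (IsCongruence.isEquivalence θ) public using (sym; trans)

module _ {c ℓ ℓ₁ ℓ₂ : Level} (L : FundamentalLattice c ℓ)
         {_∼₁_ : Rel (FundamentalLattice.Carrier L) ℓ₁} {_∼₂_ : Rel (FundamentalLattice.Carrier L) ℓ₂}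
         (θ₁ : IsCongruence L _∼₁_) (θ₂ : IsCongruence L _∼₂_) where
  open FundamentalLattice L

  diagonal-isFundamentalEmbedding : (∀ {x y} → x ∼₁ y → x ∼₂ y → x ≈ y) →
    IsFundamentalEmbedding L (L / θ₁) (L / θ₂) (λ x → lift x , lift x)
  diagonal-isFundamentalEmbedding separating = record
    { cong      = λ x≈y → θ₁.reflexive x≈y , θ₂.reflexive x≈y
    ; pres-𝟘    = reflexive₂
    ; pres-𝟙    = reflexive₂
    ; pres-∧    = λ _ _ → reflexive₂
    ; pres-∨    = λ _ _ → reflexive₂
    ; pres-¬    = λ _ → reflexive₂
    ; injective = λ (x∼₁y , x∼₂y) → separating x∼₁y x∼₂y
    }
    where
    module θ₁ = IsCongruence θ₁
    module θ₂ = IsCongruence θ₂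
    reflexive₂ : ∀ {x} → x ∼₁ x × x ∼₂ x
    reflexive₂ = θ₁.reflexive refl , θ₂.reflexive refl

∧-distribˡ-∨⇒isDistributiveLattice : ∀ {a ℓ} {A : Set a} {_≈_ : Rel A ℓ} {_∨_ _∧_ : Op₂ A} →
  IsLattice _≈_ _∨_ _∧_ → _DistributesOverˡ_ _≈_ _∧_ _∨_ → IsDistributiveLattice _≈_ _∨_ _∧_
∧-distribˡ-∨⇒isDistributiveLattice {_≈_ = _≈_} {_∨_} {_∧_} isLattice ∧-distribˡ-∨ = record
  { isLattice   = isLattice
  ; ∨-distrib-∧ = comm∧distrˡ⇒distr setoid ∧-cong ∨-comm
      (distrib∧absorbs⇒distribˡ setoid ∨-cong ∨-assoc ∧-comm ∨-absorbs-∧ ∧-absorbs-∨ ∧-distrib-∨)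
  ; ∧-distrib-∨ = ∧-distrib-∨
  }
  where
  open IsLattice isLattice
  setoid : Setoid _ _
  setoid = record { isEquivalence = isEquivalence }
  ∧-distrib-∨ : _DistributesOver_ _≈_ _∧_ _∨_
  ∧-distrib-∨ = comm∧distrˡ⇒distr setoid ∨-cong ∧-comm ∧-distribˡ-∨

module ExLatticeProperties {c ℓ : Level} (L : FundamentalLattice c ℓ) (ex : IsExLattice L) where
  open FundamentalLatticeProperties L

  private
    ex-≤ : ∀ {x} a b p q e f → x ≤ ¬ (a ∧ ((b ∧ p) ∨ (b ∧ q))) → x ≤ a → x ≤ p ∨ e → x ≤ ¬ ¬ f →
           x ≤ ¬ ¬ (a ∧ f) ∧ ((a ∧ p) ∨ (a ∧ e) ∨ f) ∧ ((b ∧ (p ∨ q)) ∨ ¬ (b ∧ (p ∨ q)))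
    ex-≤ a b p q e f x≤¬[a∧…] x≤a x≤p∨e x≤¬¬f =
      ≤-trans (∧-greatest x≤¬[a∧…] (∧-greatest x≤a (∧-greatest x≤p∨e x≤¬¬f))) (ex a b p q e f)

    ≤¬[a∧[𝟘∧p∨𝟘∧q]] : ∀ {x} a p q → x ≤ ¬ (a ∧ ((𝟘 ∧ p) ∨ (𝟘 ∧ q)))
    ≤¬[a∧[𝟘∧p∨𝟘∧q]] a p q = ≤𝟘⇒≤¬ (≤-trans (x∧y≤y _ _) (∨-least (x∧y≤x _ _) (x∧y≤x _ _)))

    ≤𝟙∨ : ∀ {x} y → x ≤ 𝟙 ∨ y
    ≤𝟙∨ y = ≤-trans (𝟙-greatest _) (x≤x∨y 𝟙 y)

    ≤¬¬𝟙 : ∀ {x} → x ≤ ¬ ¬ 𝟙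
    ≤¬¬𝟙 = ≤-trans (𝟙-greatest _) (≤-¬¬ 𝟙)

  x∧¬¬y≤¬¬[x∧y] : ∀ x y → x ∧ ¬ ¬ y ≤ ¬ ¬ (x ∧ y)
  x∧¬¬y≤¬¬[x∧y] x y =
    ≤-trans (ex-≤ x 𝟘 𝟙 𝟘 𝟘 y (≤¬[a∧[𝟘∧p∨𝟘∧q]] x 𝟙 𝟘) (x∧y≤x _ _) (≤𝟙∨ 𝟘) (x∧y≤y _ _)) (x∧y≤x _ _)

  ∧-distribˡ-∨-upto : ∀ {x a y z f} → x ≤ a → x ≤ y ∨ z → x ≤ ¬ ¬ f → x ≤ (a ∧ y) ∨ (a ∧ z) ∨ f
  ∧-distribˡ-∨-upto {a = a} {y} {z} {f} x≤a x≤y∨z x≤¬¬f =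
    ≤-trans (ex-≤ a 𝟘 y 𝟘 z f (≤¬[a∧[𝟘∧p∨𝟘∧q]] a y 𝟘) x≤a x≤y∨z x≤¬¬f) (≤-trans (x∧y≤y _ _) (x∧y≤x _ _))

  x∧y≈𝟘⇒x≤y∨¬y : ∀ {x y} → x ∧ y ≈ 𝟘 → x ≤ y ∨ ¬ y
  x∧y≈𝟘⇒x≤y∨¬y {x} {y} x∧y≈𝟘 =
    ≤-trans (ex-≤ x y 𝟙 𝟙 𝟙 𝟙 x≤¬[a∧…] ≤-refl (≤𝟙∨ 𝟙) ≤¬¬𝟙)
            (≤-trans (x∧y≤y _ _) (≤-trans (x∧y≤y _ _)
              (∨-monotonic (x∧y≤x _ _) (¬-antitone (∧-greatest ≤-refl (≤𝟙∨ 𝟙))))))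
    where
    x≤¬[a∧…] : x ≤ ¬ (x ∧ ((y ∧ 𝟙) ∨ (y ∧ 𝟙)))
    x≤¬[a∧…] = ≤𝟘⇒≤¬ (≤-trans (∧-monotonic ≤-refl (∨-least (x∧y≤x _ _) (x∧y≤x _ _))) (≤-reflexive x∧y≈𝟘))

  ¬[x∧y∨x∧z]≤x∧[y∨z]∨¬[x∧[y∨z]] : ∀ x y z →
    ¬ ((x ∧ y) ∨ (x ∧ z)) ≤ (x ∧ (y ∨ z)) ∨ ¬ (x ∧ (y ∨ z))
  ¬[x∧y∨x∧z]≤x∧[y∨z]∨¬[x∧[y∨z]] x y z =
    ≤-trans (ex-≤ 𝟙 x y z 𝟙 𝟙 (¬-antitone (x∧y≤y _ _)) (𝟙-greatest _)
                  (≤-trans (𝟙-greatest _) (y≤x∨y y 𝟙)) ≤¬¬𝟙)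
            (≤-trans (x∧y≤y _ _) (x∧y≤y _ _))

  ¬[x∧¬¬y]≈¬[x∧y] : ∀ x y → ¬ (x ∧ ¬ ¬ y) ≈ ¬ (x ∧ y)
  ¬[x∧¬¬y]≈¬[x∧y] x y = ≤-antisym
    (¬-antitone (∧-monotonic ≤-refl (≤-¬¬ y)))
    (≤-trans (≤-reflexive (sym (¬¬¬≈¬ (x ∧ y)))) (¬-antitone (x∧¬¬y≤¬¬[x∧y] x y)))

  ¬[x∧k]≈¬x : ∀ {k} x → Dense k → ¬ (x ∧ k) ≈ ¬ x
  ¬[x∧k]≈¬x {k} x k-dense = begin
    ¬ (x ∧ k)      ≈⟨ ¬[x∧¬¬y]≈¬[x∧y] x k ⟨
    ¬ (x ∧ ¬ ¬ k)  ≈⟨ ¬-cong (∧-congˡ (≈𝟘⇒¬≈𝟙 k-dense)) ⟩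
    ¬ (x ∧ 𝟙)      ≈⟨ ¬-cong (𝟙-greatest x) ⟩
    ¬ x            ∎
    where open ≈-Reasoning setoid

  ¬[¬x∧y]≈¬¬[x∨¬y] : ∀ x y → ¬ (¬ x ∧ y) ≈ ¬ ¬ (x ∨ ¬ y)
  ¬[¬x∧y]≈¬¬[x∨¬y] x y = sym (trans (¬-cong (¬-∨ x (¬ y))) (¬[x∧¬¬y]≈¬[x∧y] (¬ x) y))

  ¬-congʳ-∧ : ∀ {y z} x → ¬ y ≈ ¬ z → ¬ (x ∧ y) ≈ ¬ (x ∧ z)
  ¬-congʳ-∧ {y} {z} x ¬y≈¬z = begin
    ¬ (x ∧ y)      ≈⟨ ¬[x∧¬¬y]≈¬[x∧y] x y ⟨
    ¬ (x ∧ ¬ ¬ y)  ≈⟨ ¬-cong (∧-congˡ (¬-cong ¬y≈¬z)) ⟩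
    ¬ (x ∧ ¬ ¬ z)  ≈⟨ ¬[x∧¬¬y]≈¬[x∧y] x z ⟩
    ¬ (x ∧ z)      ∎
    where open ≈-Reasoning setoid

  -- Order modulo dense elements

  infix 4 _≤ᵈ_ _≈ᵈ_

  _≤ᵈ_ : Rel Carrier (c ⊔ ℓ)
  x ≤ᵈ y = ∀ k → Dense k → x ≤ y ∨ k

  ≤⇒≤ᵈ : ∀ {x y} → x ≤ y → x ≤ᵈ y
  ≤⇒≤ᵈ x≤y k _ = ≤-trans x≤y (x≤x∨y _ k)

  ≤ᵈ-trans : ∀ {x y z} → x ≤ᵈ y → y ≤ᵈ z → x ≤ᵈ z
  ≤ᵈ-trans x≤y y≤z k k-dense = ≤-trans (x≤y k k-dense) (∨-least (y≤z k k-dense) (y≤x∨y _ k))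

  ≤ᵈ-preorder : Preorder c ℓ (c ⊔ ℓ)
  ≤ᵈ-preorder = record
    { _≈_        = _≈_
    ; _≲_        = _≤ᵈ_
    ; isPreorder = record
      { isEquivalence = isEquivalence
      ; reflexive     = λ x≈y → ≤⇒≤ᵈ (≤-reflexive x≈y)
      ; trans         = ≤ᵈ-trans
      }
    }

  ≈ᵈ-setoid : Setoid c (c ⊔ ℓ)
  ≈ᵈ-setoid = PreorderProperties.InducedEquivalence ≤ᵈ-preorder

  _≈ᵈ_ : Rel Carrier (c ⊔ ℓ)
  _≈ᵈ_ = Setoid._≈_ ≈ᵈ-setoid

  private
    module ≈ᵈ = Setoid ≈ᵈ-setoid

  ≈⇒≈ᵈ : ∀ {x y} → x ≈ y → x ≈ᵈ y
  ≈⇒≈ᵈ x≈y = ≤⇒≤ᵈ (≤-reflexive x≈y) , ≤⇒≤ᵈ (≤-reflexive (sym x≈y))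

  ≤-dense⇒≤∧∨∧∨ : ∀ {x y z k} → Dense k → x ≤ y ∨ z → x ≤ (x ∧ y) ∨ (x ∧ z) ∨ k
  ≤-dense⇒≤∧∨∧∨ k-dense x≤y∨z =
    ∧-distribˡ-∨-upto ≤-refl x≤y∨z (≤-trans (𝟙-greatest _) (≤-reflexive (sym (≈𝟘⇒¬≈𝟙 k-dense))))

  ≤ᵈ-cases : ∀ {x y z w} → x ≤ y ∨ z → x ∧ y ≤ᵈ w → x ∧ z ≤ᵈ w → x ≤ᵈ w
  ≤ᵈ-cases x≤y∨z x∧y≤w x∧z≤w k k-dense = ≤-trans (≤-dense⇒≤∧∨∧∨ k-dense x≤y∨z)
    (∨-least (x∧y≤w k k-dense) (∨-least (x∧z≤w k k-dense) (y≤x∨y _ k)))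

  ∧-monoˡ-≤ᵈ : ∀ {x y} z → x ≤ᵈ y → x ∧ z ≤ᵈ y ∧ z
  ∧-monoˡ-≤ᵈ z x≤y k k-dense = ≤-trans (≤-dense⇒≤∧∨∧∨ k-dense (≤-trans (x∧y≤x _ _) (x≤y k k-dense)))
    (∨-least (≤-trans (∧-greatest (x∧y≤y _ _) (≤-trans (x∧y≤x _ _) (x∧y≤y _ _))) (x≤x∨y _ k))
             (∨-least (≤-trans (x∧y≤y _ _) (y≤x∨y _ k)) (y≤x∨y _ k)))

  ∧-greatestᵈ : ∀ {x y z} → x ≤ᵈ y → x ≤ᵈ z → x ≤ᵈ y ∧ z
  ∧-greatestᵈ {x} {y} {z} x≤y x≤z = begin
    x      ≈⟨ ∧-idem x ⟨
    x ∧ x  ≲⟨ ∧-monoˡ-≤ᵈ x x≤y ⟩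
    y ∧ x  ≈⟨ ∧-comm y x ⟩
    x ∧ y  ≲⟨ ∧-monoˡ-≤ᵈ y x≤z ⟩
    z ∧ y  ≈⟨ ∧-comm z y ⟩
    y ∧ z  ∎
    where open PreorderReasoning ≤ᵈ-preorder

  ∧-congʳ-≈ᵈ : ∀ {x y} z → x ≈ᵈ y → x ∧ z ≈ᵈ y ∧ z
  ∧-congʳ-≈ᵈ z (x≤y , y≤x) = ∧-monoˡ-≤ᵈ z x≤y , ∧-monoˡ-≤ᵈ z y≤x

  ∨-congʳ-≈ᵈ : ∀ {x y} z → x ≈ᵈ y → x ∨ z ≈ᵈ y ∨ z
  ∨-congʳ-≈ᵈ z (x≤y , y≤x) = ∨-monoˡ z x≤y , ∨-monoˡ z y≤x
    where
    ∨-monoˡ : ∀ {x y} z → x ≤ᵈ y → x ∨ z ≤ᵈ y ∨ z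
    ∨-monoˡ z x≤y k k-dense = ∨-least (≤-trans (x≤y k k-dense) (∨-monotonic (x≤x∨y _ z) ≤-refl))
                                      (≤-trans (y≤x∨y _ z) (x≤x∨y _ k))

  x∧y≈𝟘⇒x≤ᵈ¬y : ∀ {x y} → x ∧ y ≈ 𝟘 → x ≤ᵈ ¬ y
  x∧y≈𝟘⇒x≤ᵈ¬y x∧y≈𝟘 = ≤ᵈ-cases (x∧y≈𝟘⇒x≤y∨¬y x∧y≈𝟘)
    (≤⇒≤ᵈ (≤-trans (≤-reflexive x∧y≈𝟘) (𝟘-least _))) (≤⇒≤ᵈ (x∧y≤y _ _))

  ¬[x∧y∨x∧z]≤ᵈ¬[x∧[y∨z]] : ∀ x y z → ¬ ((x ∧ y) ∨ (x ∧ z)) ≤ᵈ ¬ (x ∧ (y ∨ z))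
  ¬[x∧y∨x∧z]≤ᵈ¬[x∧[y∨z]] x y z =
    ≤ᵈ-cases (¬[x∧y∨x∧z]≤x∧[y∨z]∨¬[x∧[y∨z]] x y z) ¬u∧v≤ᵈ¬v (≤⇒≤ᵈ (x∧y≤y _ _))
    where
    u v : Carrier
    u = (x ∧ y) ∨ (x ∧ z)
    v = x ∧ (y ∨ z)
    ¬u∧v∧w≤ᵈ¬v : ∀ {w} → x ∧ w ≤ u → (¬ u ∧ v) ∧ w ≤ᵈ ¬ v
    ¬u∧v∧w≤ᵈ¬v x∧w≤u = ≤⇒≤ᵈ (≤-trans (≤∧≤¬⇒≤𝟘
      (≤-trans (∧-monotonic (≤-trans (x∧y≤y _ _) (x∧y≤x _ _)) ≤-refl) x∧w≤u)
      (≤-trans (x∧y≤x _ _) (x∧y≤x _ _))) (𝟘-least _))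
    ¬u∧v≤ᵈ¬v : ¬ u ∧ v ≤ᵈ ¬ v
    ¬u∧v≤ᵈ¬v = ≤ᵈ-cases (≤-trans (x∧y≤y _ _) (x∧y≤y _ _))
      (¬u∧v∧w≤ᵈ¬v (x≤x∨y _ _)) (¬u∧v∧w≤ᵈ¬v (y≤x∨y _ _))

  ¬[[x∨y]∧z]≈ᵈ¬[x∧z]∧¬[y∧z] : ∀ x y z → ¬ ((x ∨ y) ∧ z) ≈ᵈ ¬ (x ∧ z) ∧ ¬ (y ∧ z)
  ¬[[x∨y]∧z]≈ᵈ¬[x∧z]∧¬[y∧z] x y z =
    ≤⇒≤ᵈ (∧-greatest (¬-antitone (∧-monotonic (x≤x∨y x y) ≤-refl))
                     (¬-antitone (∧-monotonic (y≤x∨y x y) ≤-refl))) ,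
    (begin
      ¬ (x ∧ z) ∧ ¬ (y ∧ z)  ≈⟨ ¬-∨ _ _ ⟨
      ¬ ((x ∧ z) ∨ (y ∧ z))  ≈⟨ ¬-cong (∨-cong (∧-comm x z) (∧-comm y z)) ⟩
      ¬ ((z ∧ x) ∨ (z ∧ y))  ≲⟨ ¬[x∧y∨x∧z]≤ᵈ¬[x∧[y∨z]] z x y ⟩
      ¬ (z ∧ (x ∨ y))        ≈⟨ ¬-cong (∧-comm z (x ∨ y)) ⟩
      ¬ ((x ∨ y) ∧ z)        ∎)
    where open PreorderReasoning ≤ᵈ-preorder

  𝟙≤ᵈ¬[x∧y]⇒y≤ᵈ¬x : ∀ {x y} → 𝟙 ≤ᵈ ¬ (x ∧ y) → y ≤ᵈ ¬ x
  𝟙≤ᵈ¬[x∧y]⇒y≤ᵈ¬x {x} {y} 𝟙≤¬[x∧y] = begin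
    y                  ≲⟨ ∧-greatestᵈ (≤⇒≤ᵈ ≤-refl) (≤ᵈ-trans (≤⇒≤ᵈ (𝟙-greatest y)) 𝟙≤¬[x∧y]) ⟩
    y ∧ ¬ (x ∧ y)      ≲⟨ x∧y≈𝟘⇒x≤ᵈ¬y (≤𝟘⇒≈𝟘 (≤∧≤¬⇒≤𝟘
                            (∧-greatest (x∧y≤y _ _) (≤-trans (x∧y≤x _ _) (x∧y≤x _ _)))
                            (≤-trans (x∧y≤x _ _) (x∧y≤y _ _)))) ⟩
    ¬ x                ∎
    where open PreorderReasoning ≤ᵈ-preorder

  𝟙≤ᵈ¬[x∧y]⇒¬[¬x∧y]≤ᵈ¬y : ∀ {x y} → 𝟙 ≤ᵈ ¬ (x ∧ y) → ¬ (¬ x ∧ y) ≤ᵈ ¬ y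
  𝟙≤ᵈ¬[x∧y]⇒¬[¬x∧y]≤ᵈ¬y {x} {y} 𝟙≤¬[x∧y] = begin
    ¬ (¬ x ∧ y)                ≲⟨ ∧-greatestᵈ (≤ᵈ-trans (≤⇒≤ᵈ (𝟙-greatest _)) 𝟙≤¬[x∧y]) (≤⇒≤ᵈ ≤-refl) ⟩
    ¬ (x ∧ y) ∧ ¬ (¬ x ∧ y)    ≲⟨ proj₂ (¬[[x∨y]∧z]≈ᵈ¬[x∧z]∧¬[y∧z] x (¬ x) y) ⟩
    ¬ ((x ∨ ¬ x) ∧ y)          ≈⟨ ¬-cong (∧-comm _ y) ⟩
    ¬ (y ∧ (x ∨ ¬ x))          ≈⟨ ¬[x∧k]≈¬x y (x∨¬x-dense x) ⟩
    ¬ y                        ∎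
    where open PreorderReasoning ≤ᵈ-preorder

  -- The Heyting congruence

  infix 4 _≈ᴴ_

  _≈ᴴ_ : Rel Carrier (c ⊔ ℓ)
  x ≈ᴴ y = x ≈ᵈ y × (∀ z → ¬ (x ∧ z) ≈ᵈ ¬ (y ∧ z))

  ≈⇒≈ᴴ : ∀ {x y} → x ≈ y → x ≈ᴴ y
  ≈⇒≈ᴴ x≈y = ≈⇒≈ᵈ x≈y , λ z → ≈⇒≈ᵈ (¬-cong (∧-congʳ x≈y))

  ≈ᴴ-sym : ∀ {x y} → x ≈ᴴ y → y ≈ᴴ x
  ≈ᴴ-sym (x≈y , ¬x∧≈¬y∧) = ≈ᵈ.sym x≈y , λ z → ≈ᵈ.sym (¬x∧≈¬y∧ z)

  ≈ᴴ-trans : ∀ {x y z} → x ≈ᴴ y → y ≈ᴴ z → x ≈ᴴ z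
  ≈ᴴ-trans (x≈y , ¬x∧≈¬y∧) (y≈z , ¬y∧≈¬z∧) = ≈ᵈ.trans x≈y y≈z , λ w → ≈ᵈ.trans (¬x∧≈¬y∧ w) (¬y∧≈¬z∧ w)

  ∧-congʳ-≈ᴴ : ∀ {x y} z → x ≈ᴴ y → x ∧ z ≈ᴴ y ∧ z
  ∧-congʳ-≈ᴴ {x} {y} z (x≈y , ¬x∧≈¬y∧) = ∧-congʳ-≈ᵈ z x≈y , λ w → begin
    ¬ ((x ∧ z) ∧ w)  ≈⟨ ≈⇒≈ᵈ (¬-cong (∧-assoc x z w)) ⟩
    ¬ (x ∧ (z ∧ w))  ≈⟨ ¬x∧≈¬y∧ (z ∧ w) ⟩
    ¬ (y ∧ (z ∧ w))  ≈⟨ ≈⇒≈ᵈ (¬-cong (∧-assoc y z w)) ⟨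
    ¬ ((y ∧ z) ∧ w)  ∎
    where open ≈-Reasoning ≈ᵈ-setoid

  ∨-congʳ-≈ᴴ : ∀ {x y} z → x ≈ᴴ y → x ∨ z ≈ᴴ y ∨ z
  ∨-congʳ-≈ᴴ {x} {y} z (x≈y , ¬x∧≈¬y∧) = ∨-congʳ-≈ᵈ z x≈y , λ w → begin
    ¬ ((x ∨ z) ∧ w)        ≈⟨ ¬[[x∨y]∧z]≈ᵈ¬[x∧z]∧¬[y∧z] x z w ⟩
    ¬ (x ∧ w) ∧ ¬ (z ∧ w)  ≈⟨ ∧-congʳ-≈ᵈ (¬ (z ∧ w)) (¬x∧≈¬y∧ w) ⟩
    ¬ (y ∧ w) ∧ ¬ (z ∧ w)  ≈⟨ ¬[[x∨y]∧z]≈ᵈ¬[x∧z]∧¬[y∧z] y z w ⟨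
    ¬ ((y ∨ z) ∧ w)        ∎
    where open ≈-Reasoning ≈ᵈ-setoid

  ≈ᴴ⇒¬¬≤ᵈ¬¬ : ∀ {x y} → x ≈ᴴ y → ¬ ¬ x ≤ᵈ ¬ ¬ y
  ≈ᴴ⇒¬¬≤ᵈ¬¬ {x} {y} (_ , ¬x∧≈¬y∧) = 𝟙≤ᵈ¬[x∧y]⇒y≤ᵈ¬x (begin
    𝟙                  ≈⟨ ≈𝟘⇒¬≈𝟙 (∧-¬ y) ⟨
    ¬ (y ∧ ¬ y)        ≲⟨ proj₂ (¬x∧≈¬y∧ (¬ y)) ⟩
    ¬ (x ∧ ¬ y)        ≈⟨ ¬-cong (∧-comm x (¬ y)) ⟩
    ¬ (¬ y ∧ x)        ≈⟨ ¬[x∧¬¬y]≈¬[x∧y] (¬ y) x ⟨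
    ¬ (¬ y ∧ ¬ ¬ x)    ∎)
    where open PreorderReasoning ≤ᵈ-preorder

  ¬-cong-≈ᴴ : ∀ {x y} → x ≈ᴴ y → ¬ x ≈ᴴ ¬ y
  ¬-cong-≈ᴴ {x} {y} x≈y@(_ , ¬x∧≈¬y∧) =
    ¬x≈¬y , λ z → ¬[¬x∧z]≤ᵈ¬[¬y∧z] x≈y z , ¬[¬x∧z]≤ᵈ¬[¬y∧z] (≈ᴴ-sym x≈y) z
    where
    ¬x≈¬y : ¬ x ≈ᵈ ¬ y
    ¬x≈¬y = ≈ᵈ.trans (≈⇒≈ᵈ (¬-cong (sym (𝟙-greatest x))))
              (≈ᵈ.trans (¬x∧≈¬y∧ 𝟙) (≈⇒≈ᵈ (¬-cong (𝟙-greatest y))))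
    ¬[¬x∧z]≤ᵈ¬[¬y∧z] : ∀ {x y} → x ≈ᴴ y → ∀ z → ¬ (¬ x ∧ z) ≤ᵈ ¬ (¬ y ∧ z)
    ¬[¬x∧z]≤ᵈ¬[¬y∧z] {x} {y} x≈y z = begin
      ¬ (¬ x ∧ z)    ≈⟨ ¬[¬x∧y]≈¬¬[x∨¬y] x z ⟩
      ¬ ¬ (x ∨ ¬ z)  ≲⟨ ≈ᴴ⇒¬¬≤ᵈ¬¬ (∨-congʳ-≈ᴴ (¬ z) x≈y) ⟩
      ¬ ¬ (y ∨ ¬ z)  ≈⟨ ¬[¬x∧y]≈¬¬[x∨¬y] y z ⟨
      ¬ (¬ y ∧ z)    ∎
      where open PreorderReasoning ≤ᵈ-preorder

  ≈ᴴ-isCongruence : IsCongruence L _≈ᴴ_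
  ≈ᴴ-isCongruence = record
    { isEquivalence = record { refl = ≈⇒≈ᴴ refl ; sym = ≈ᴴ-sym ; trans = ≈ᴴ-trans }
    ; reflexive     = ≈⇒≈ᴴ
    ; ∧-cong        = congʳ⇒cong ∧-comm ∧-congʳ-≈ᴴ
    ; ∨-cong        = congʳ⇒cong ∨-comm ∨-congʳ-≈ᴴ
    ; ¬-cong        = ¬-cong-≈ᴴ
    }
    where
    congʳ⇒cong : ∀ {_∙_} → (∀ x y → (x ∙ y) ≈ (y ∙ x)) →
                 (∀ {x y} z → x ≈ᴴ y → (x ∙ z) ≈ᴴ (y ∙ z)) → Congruent₂ _≈ᴴ_ _∙_
    congʳ⇒cong comm congʳ {x} {y} {u} {v} x≈y u≈v =
      ≈ᴴ-trans (congʳ u x≈y) (≈ᴴ-trans (≈⇒≈ᴴ (comm y u))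
        (≈ᴴ-trans (congʳ y u≈v) (≈⇒≈ᴴ (comm v y))))

  ∧-distribˡ-∨-≈ᴴ : ∀ x y z → x ∧ (y ∨ z) ≈ᴴ (x ∧ y) ∨ (x ∧ z)
  ∧-distribˡ-∨-≈ᴴ x y z =
    (v≤ᵈu , ≤⇒≤ᵈ u≤v) , λ w → ≤⇒≤ᵈ (¬-antitone (∧-monotonic u≤v ≤-refl)) , ¬[u∧w]≤ᵈ¬[v∧w] w
    where
    u v : Carrier
    u = (x ∧ y) ∨ (x ∧ z)
    v = x ∧ (y ∨ z)
    u≤v : u ≤ v
    u≤v = ∨-least (∧-monotonic ≤-refl (x≤x∨y y z)) (∧-monotonic ≤-refl (y≤x∨y y z))
    v≤ᵈu : v ≤ᵈ u
    v≤ᵈu = ≤ᵈ-cases (x∧y≤y _ _)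
      (≤⇒≤ᵈ (≤-trans (∧-monotonic (x∧y≤x _ _) ≤-refl) (x≤x∨y _ _)))
      (≤⇒≤ᵈ (≤-trans (∧-monotonic (x∧y≤x _ _) ≤-refl) (y≤x∨y _ _)))
    [x∧w]∧t≤u∧w : ∀ {t w} → x ∧ t ≤ u → (x ∧ w) ∧ t ≤ u ∧ w
    [x∧w]∧t≤u∧w x∧t≤u = ∧-greatest (≤-trans (∧-monotonic (x∧y≤x _ _) ≤-refl) x∧t≤u)
                                   (≤-trans (x∧y≤x _ _) (x∧y≤y _ _))
    ¬[u∧w]≤ᵈ¬[v∧w] : ∀ w → ¬ (u ∧ w) ≤ᵈ ¬ (v ∧ w)
    ¬[u∧w]≤ᵈ¬[v∧w] w = begin
      ¬ (u ∧ w)                          ≲⟨ ≤⇒≤ᵈ (¬-antitone (∨-least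
                                              ([x∧w]∧t≤u∧w (x≤x∨y _ _)) ([x∧w]∧t≤u∧w (y≤x∨y _ _)))) ⟩
      ¬ (((x ∧ w) ∧ y) ∨ ((x ∧ w) ∧ z))  ≲⟨ ¬[x∧y∨x∧z]≤ᵈ¬[x∧[y∨z]] (x ∧ w) y z ⟩
      ¬ ((x ∧ w) ∧ (y ∨ z))              ≲⟨ ≤⇒≤ᵈ (¬-antitone (∧-greatest
                                              (∧-monotonic (x∧y≤x _ _) ≤-refl)
                                              (≤-trans (x∧y≤x _ _) (x∧y≤y _ _)))) ⟩
      ¬ (v ∧ w)                          ∎
      where open PreorderReasoning ≤ᵈ-preorder

  x∧y≈ᴴ𝟘⇒y∧¬x≈ᴴy : ∀ x y → x ∧ y ≈ᴴ 𝟘 → y ∧ ¬ x ≈ᴴ y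
  x∧y≈ᴴ𝟘⇒y∧¬x≈ᴴy x y (_ , ¬[x∧y∧]≈¬[𝟘∧]) =
    (≤⇒≤ᵈ (x∧y≤x _ _) , ∧-greatestᵈ (≤⇒≤ᵈ ≤-refl) (𝟙≤ᵈ¬[x∧y]⇒y≤ᵈ¬x 𝟙≤ᵈ¬[x∧y])) ,
    λ z → ¬[y∧¬x∧z]≤ᵈ¬[y∧z] z , ≤⇒≤ᵈ (¬-antitone (∧-monotonic (x∧y≤x _ _) ≤-refl))
    where
    open PreorderReasoning ≤ᵈ-preorder
    𝟙≤ᵈ¬[x∧[y∧z]] : ∀ z → 𝟙 ≤ᵈ ¬ (x ∧ (y ∧ z))
    𝟙≤ᵈ¬[x∧[y∧z]] z = begin
      𝟙                ≈⟨ ¬𝟘≈𝟙 ⟨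
      ¬ 𝟘              ≈⟨ ¬-cong (𝟘-least z) ⟨
      ¬ (𝟘 ∧ z)        ≲⟨ proj₂ (¬[x∧y∧]≈¬[𝟘∧] z) ⟩
      ¬ ((x ∧ y) ∧ z)  ≈⟨ ¬-cong (∧-assoc x y z) ⟩
      ¬ (x ∧ (y ∧ z))  ∎
    𝟙≤ᵈ¬[x∧y] : 𝟙 ≤ᵈ ¬ (x ∧ y)
    𝟙≤ᵈ¬[x∧y] = ≤ᵈ-trans (𝟙≤ᵈ¬[x∧[y∧z]] 𝟙) (≤⇒≤ᵈ (≤-reflexive (¬-cong (∧-congˡ (𝟙-greatest y)))))
    ¬[y∧¬x∧z]≤ᵈ¬[y∧z] : ∀ z → ¬ ((y ∧ ¬ x) ∧ z) ≤ᵈ ¬ (y ∧ z)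
    ¬[y∧¬x∧z]≤ᵈ¬[y∧z] z = begin
      ¬ ((y ∧ ¬ x) ∧ z)  ≈⟨ ¬-cong (trans (∧-congʳ (∧-comm y (¬ x))) (∧-assoc (¬ x) y z)) ⟩
      ¬ (¬ x ∧ (y ∧ z))  ≲⟨ 𝟙≤ᵈ¬[x∧y]⇒¬[¬x∧y]≤ᵈ¬y (𝟙≤ᵈ¬[x∧[y∧z]] z) ⟩
      ¬ (y ∧ z)          ∎

  -- The orthocongruence and separation

  infix 4 _≈ᴼ_

  _≈ᴼ_ : Rel Carrier (c ⊔ ℓ)
  x ≈ᴼ y = Lift c (¬ x ≈ ¬ y)

  ≈ᴼ-isCongruence : IsCongruence L _≈ᴼ_
  ≈ᴼ-isCongruence = record
    { isEquivalence = record
      { refl  = lift refl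
      ; sym   = λ (lift ¬x≈¬y) → lift (sym ¬x≈¬y)
      ; trans = λ (lift ¬x≈¬y) (lift ¬y≈¬z) → lift (trans ¬x≈¬y ¬y≈¬z)
      }
    ; reflexive     = λ x≈y → lift (¬-cong x≈y)
    ; ∧-cong        = λ {x} {y} {u} {v} (lift ¬x≈¬y) (lift ¬u≈¬v) → lift (begin
        ¬ (x ∧ u)  ≈⟨ ¬-congʳ-∧ x ¬u≈¬v ⟩
        ¬ (x ∧ v)  ≈⟨ ¬-cong (∧-comm x v) ⟩
        ¬ (v ∧ x)  ≈⟨ ¬-congʳ-∧ v ¬x≈¬y ⟩
        ¬ (v ∧ y)  ≈⟨ ¬-cong (∧-comm v y) ⟩
        ¬ (y ∧ v)  ∎)
    ; ∨-cong        = λ {x} {y} {u} {v} (lift ¬x≈¬y) (lift ¬u≈¬v) →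
        lift (trans (¬-∨ x u) (trans (∧-cong ¬x≈¬y ¬u≈¬v) (sym (¬-∨ y v))))
    ; ¬-cong        = λ (lift ¬x≈¬y) → lift (¬-cong ¬x≈¬y)
    }
    where open ≈-Reasoning setoid

  x≈¬¬x∧[x∨¬x] : ∀ x → x ≈ ¬ ¬ x ∧ (x ∨ ¬ x)
  x≈¬¬x∧[x∨¬x] x = ≤-antisym (∧-greatest (≤-¬¬ x) (x≤x∨y x (¬ x)))
    (≤-trans (∧-distribˡ-∨-upto (x∧y≤x _ _) (x∧y≤y _ _) (x∧y≤x _ _))
             (∨-least (x∧y≤y _ _) (∨-least (≤-trans (≤-reflexive ¬¬x∧¬x≈𝟘) (𝟘-least x)) ≤-refl)))
    where
    ¬¬x∧¬x≈𝟘 : ¬ ¬ x ∧ ¬ x ≈ 𝟘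
    ¬¬x∧¬x≈𝟘 = trans (∧-comm _ _) (∧-¬ (¬ x))

  ¬≈¬∧≈ᵈ⇒≈ : ∀ {x y} → ¬ x ≈ ¬ y → x ≈ᵈ y → x ≈ y
  ¬≈¬∧≈ᵈ⇒≈ {x} {y} ¬x≈¬y (x≤ᵈy , y≤ᵈx) = begin
    x                  ≈⟨ x≈¬¬x∧[x∨¬x] x ⟩
    ¬ ¬ x ∧ (x ∨ ¬ x)  ≈⟨ ∧-cong (¬-cong ¬x≈¬y) (≤-antisym
                            (x∨¬x≤y∨¬y x≤ᵈy (≤-reflexive ¬x≈¬y))
                            (x∨¬x≤y∨¬y y≤ᵈx (≤-reflexive (sym ¬x≈¬y)))) ⟩
    ¬ ¬ y ∧ (y ∨ ¬ y)  ≈⟨ x≈¬¬x∧[x∨¬x] y ⟨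
    y                  ∎
    where
    open ≈-Reasoning setoid
    x∨¬x≤y∨¬y : ∀ {x y} → x ≤ᵈ y → ¬ x ≤ ¬ y → x ∨ ¬ x ≤ y ∨ ¬ y
    x∨¬x≤y∨¬y {y = y} x≤ᵈy ¬x≤¬y = ∨-least
      (≤-trans (x≤ᵈy (y ∨ ¬ y) (x∨¬x-dense y)) (∨-least (x≤x∨y _ _) ≤-refl))
      (≤-trans ¬x≤¬y (y≤x∨y _ _))

  L/≈ᴼ-isOrtholattice : IsOrtholattice (L / ≈ᴼ-isCongruence)
  L/≈ᴼ-isOrtholattice x = lift (¬¬¬≈¬ (lower x))

  L/≈ᴴ-isHeytingLattice : IsHeytingLattice (L / ≈ᴴ-isCongruence)
  L/≈ᴴ-isHeytingLattice = record
    { distributive = ∧-distribˡ-∨⇒isDistributiveLattice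
                       (FundamentalLattice.isLattice (L / ≈ᴴ-isCongruence))
                       (λ x y z → ∧-distribˡ-∨-≈ᴴ (lower x) (lower y) (lower z))
    ; pseudocompl  = λ x y → x∧y≈ᴴ𝟘⇒y∧¬x≈ᴴy (lower x) (lower y)
    }

  ≈ᴼ∧≈ᴴ⇒≈ : ∀ {x y} → x ≈ᴼ y → x ≈ᴴ y → x ≈ y
  ≈ᴼ∧≈ᴴ⇒≈ (lift ¬x≈¬y) (x≈ᵈy , _) = ¬≈¬∧≈ᵈ⇒≈ ¬x≈¬y x≈ᵈy

theorem4p1 : {c ℓ : Level} (L : FundamentalLattice c ℓ) → IsExLattice L →
    Σ (FundamentalLattice (c ⊔ ℓ) (c ⊔ ℓ)) λ O → Σ (FundamentalLattice (c ⊔ ℓ) (c ⊔ ℓ)) λ A →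
      IsOrtholattice O × IsHeytingLattice A ×
      Σ (FundamentalLattice.Carrier L → FundamentalLattice.Carrier O × FundamentalLattice.Carrier A) λ e →
        IsFundamentalEmbedding L O A e
theorem4p1 L ex =
    L / ≈ᴼ-isCongruence
  , L / ≈ᴴ-isCongruence
  , L/≈ᴼ-isOrtholattice
  , L/≈ᴴ-isHeytingLattice
  , (λ x → lift x , lift x)
  , diagonal-isFundamentalEmbedding L ≈ᴼ-isCongruence ≈ᴴ-isCongruence ≈ᴼ∧≈ᴴ⇒≈
  where open ExLatticeProperties L ex
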